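{- Let $N$ and $\widetilde{N}$ be sets of labelled clauses such that $\widetilde{N} \subseteq N$ and for every $\mathcal{D} \in N \setminus \widetilde{N}$ there exists $\mathcal{C} \in \widetilde{N}$ such that $\mathcal{C}$ subsumes $\mathcal{D}$. Then for every $K \in \mathbb{N}$ and $L \in \mathbb{N}^+$, $N$ is $(K,L)$-satisfiable if and only if $\widetilde{N}$ is $(K,L)$-satisfiable.
   Context: $\Sigma$ is a finite set of propositional variables. For each $i \in \mathbb{N}$ let $\Sigma^{(i)} = \{p^{(i)} : p \in \Sigma\}$ be pairwise disjoint copies of $\Sigma$ (with $p^{(0)} = p$), and $\Sigma^* = \bigcup_{i} \Sigma^{(i)}$. A standard clause is a finite set (disjunction) of literals over $\Sigma^*$. For a standard clause $C$ and $t \in \mathbb{N}$, $C^{(t)}$ is obtained by replacing every variable $q^{(i)}$ in $C$ by $q^{(i+t)}$; $C' = C^{(1)}$. A label is a triple $(b,k,l) \in \{*,0\} \times (\{*\} \cup \mathbb{N}) \times \mathbb{N}$; a labelled clause $\langle (b,k,l) \rangle C$ is a pair of a label and a standard clause. For $K \in \mathbb{N}$, $L \in \mathbb{N}^+$, $R_{(K,L)}(b,k,l)$ is the set of all $t \in \mathbb{N}$ such that (1) if $b \neq *$ then $t = 0$; (2) if $k \neq *$ then $t + k = K + sL$ for some $s \in \mathbb{N}$; (3) $L$ divides $l$. For a set $N$ of labelled clauses, $N_{(K,L)} = \{C^{(t)} : \langle (b,k,l)\rangle C \in N,\ t \in R_{(K,L)}(b,k,l)\}$, and $N$ is $(K,L)$-satisfiable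 if some valuation $W^*: \Sigma^* \to \{0,1\}$ satisfies every clause of $N_{(K,L)}$. The merge of labels $(b_1,k_1,l_1)$ and $(b_2,k_2,l_2)$ is $(b,k,l)$ with: $b = b_2$ if $b_1 = *$, else $b = b_1$ if $b_2 = *$, else $b = 0$; $k = k_2$ if $k_1 = *$, else $k = k_1$ if $k_2 = *$, else $k = \min(k_1,k_2)$; $l = \gcd(l_1,l_2)$ if $k_1 = *$ or $k_2 = *$, else $l = \gcd(l_1,l_2,k_1-k_2)$ (gcd of absolute values, $\gcd(x,0)=x$). Time shift: $\langle (*,*,l)\rangle C \leadsto \langle (*,*,l)\rangle C'$ and $\langle (*,k,l)\rangle C \leadsto \langle (*,k+1,l)\rangle C'$ for $k \in \mathbb{N}$ (undefined when the first label component is $0$). Subsumption: $\langle (b_1,k_1,l_1)\rangle C$ subsumes $\langle (b_2,k_2,l_2)\rangle D$ in the basic sense if $C \subseteq D$ and the merge of $(b_1,k_1,l_1)$ and $(b_2,k_2,l_2)$ equals $(b_2,k_2,l_2)$. A labelled clause $\mathcal{C}$ subsumes $\mathcal{D}$ if $\mathcal{C}$, or a labelled clause obtained from $\mathcal{C}$ by finitely many applications of the time shift, subsumes $\mathcal{D}$ in the basic sense. -}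

module Defs where

open import Data.Nat using (ℕ; _+_; _*_; ∣_-_∣; _⊓_)
open import Data.Unit using (⊤)
open import Data.Nat.GCD using (gcd)
open import Data.Nat.Divisibility using (_∣_)
open import Data.Fin using (Fin)
open import Data.Bool using (Bool; true; false; not)
open import Data.Maybe using (Maybe; just; nothing)
open import Data.List using (List; map)
open import Data.List.Relation.Unary.Any using (Any)
open import Data.List.Membership.Propositional using () renaming (_∈_ to _∈ˡ_)
open import Data.Product using (_×_; _,_; ∃)
open import Relation.Binary.PropositionalEquality using (_≡_)
open import Relation.Binary.Construct.Closure.ReflexiveTransitive using (Star)
open import Relation.Nullary using (¬_)

-- Σ = Fin n (a finite set of propositional variables).
-- A variable of Σ* is p^(i), represented as a pair (p , i).
Var : ℕ → Set
Var n = Fin n × ℕ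

data Lit (n : ℕ) : Set where
  pos : Var n → Lit n
  neg : Var n → Lit n

Clause : ℕ → Set
Clause n = List (Lit n)

shiftVar : ∀ {n} → ℕ → Var n → Var n
shiftVar t (p , i) = (p , i + t)

shiftLit : ∀ {n} → ℕ → Lit n → Lit n
shiftLit t (pos v) = pos (shiftVar t v)
shiftLit t (neg v) = neg (shiftVar t v)

shiftClause : ∀ {n} → ℕ → Clause n → Clause n
shiftClause t C = map (shiftLit t) C

data B : Set where
  ⋆ : B
  𝟘 : B

-- label (b, k, l); k = nothing means k = *
record Label : Set where
  constructor ⟨_,_,_⟩
  field
    b : B
    k : Maybe ℕ
    l : ℕ

record LClause (n : ℕ) : Set where
  constructor _▸_
  field
    label  : Label
    clause : Clause n

open Label
open LClause

condB : B → ℕ → Set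
condB ⋆ t = ⊤
condB 𝟘 t = t ≡ 0

condK : (K L : ℕ) → Maybe ℕ → ℕ → Set
condK K L nothing  t = ⊤
condK K L (just k) t = ∃ λ (s : ℕ) → t + k ≡ K + s * L

InR : (K L : ℕ) → Label → ℕ → Set
InR K L ⟨ b , k , l ⟩ t = condB b t × condK K L k t × (L ∣ l)

Valuation : ℕ → Set
Valuation n = Var n → Bool

litVal : ∀ {n} → Valuation n → Lit n → Bool
litVal W (pos v) = W v
litVal W (neg v) = not (W v)

Satisfies : ∀ {n} → Valuation n → Clause n → Set
Satisfies W C = Any (λ x → litVal W x ≡ true) C

-- sets of labelled clauses (arbitrary, as predicates)
LSet : ℕ → Set₁
LSet n = LClause n → Set

Satisfiable : ∀ {n} → (K L : ℕ) → LSet n → Set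
Satisfiable {n} K L N =
  ∃ λ (W : Valuation n) → ∀ (𝒞 : LClause n) → N 𝒞 →
    ∀ (t : ℕ) → InR K L (label 𝒞) t → Satisfies W (shiftClause t (clause 𝒞))

mergeB : B → B → B
mergeB ⋆ b₂ = b₂
mergeB 𝟘 ⋆ = 𝟘
mergeB 𝟘 𝟘 = 𝟘

mergeK : Maybe ℕ → Maybe ℕ → Maybe ℕ
mergeK nothing k₂ = k₂
mergeK (just k₁) nothing = just k₁
mergeK (just k₁) (just k₂) = just (k₁ ⊓ k₂)

mergeL : Maybe ℕ → Maybe ℕ → ℕ → ℕ → ℕ
mergeL (just k₁) (just k₂) l₁ l₂ = gcd (gcd l₁ l₂) ∣ k₁ - k₂ ∣
mergeL _ _ l₁ l₂ = gcd l₁ l₂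

merge : Label → Label → Label
merge ⟨ b₁ , k₁ , l₁ ⟩ ⟨ b₂ , k₂ , l₂ ⟩ =
  ⟨ mergeB b₁ b₂ , mergeK k₁ k₂ , mergeL k₁ k₂ l₁ l₂ ⟩

-- one time-shift step (undefined when b = 0)
data TimeShift {n : ℕ} : LClause n → LClause n → Set where
  shift-* : ∀ l C → TimeShift (⟨ ⋆ , nothing , l ⟩ ▸ C) (⟨ ⋆ , nothing , l ⟩ ▸ shiftClause 1 C)
  shift-k : ∀ k l C → TimeShift (⟨ ⋆ , just k , l ⟩ ▸ C) (⟨ ⋆ , just (1 + k) , l ⟩ ▸ shiftClause 1 C)

_⊆ᶜ_ : ∀ {n} → Clause n → Clause n → Set
C ⊆ᶜ D = ∀ {x} → x ∈ˡ C → x ∈ˡ D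

BasicSubsumes : ∀ {n} → LClause n → LClause n → Set
BasicSubsumes (λ₁ ▸ C) (λ₂ ▸ D) = C ⊆ᶜ D × merge λ₁ λ₂ ≡ λ₂

Subsumes : ∀ {n} → LClause n → LClause n → Set
Subsumes {n} 𝒞 𝒟 = ∃ λ (𝒞' : LClause n) → Star TimeShift 𝒞 𝒞' × BasicSubsumes 𝒞' 𝒟

-- A subsumed clause is redundant: if 𝒞 subsumes 𝒟, every instance of 𝒟 in N_(K,L)
-- contains (as a sub-clause) some instance of 𝒞. A time shift of 𝒞 only renames which
-- instance C^(t) is used, and a basic subsumption merge(λ₁, λ₂) = λ₂ forces every time
-- admissible for λ₂ to be admissible for λ₁: λ₂ is at least as restrictive in
-- b and k, and its period l₂ divides both l₁ and the offset k₁ − k₂.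
module Submission where

open import Defs
open import Data.Nat using (ℕ; NonZero; suc; _+_; _*_; _∸_; _≤_; ∣_-_∣)
open import Data.Nat.Properties
  using (+-assoc; +-suc; *-distribʳ-+; m+[n∸m]≡n; m⊓n≡n⇒n≤m; m≤n⇒∣n-m∣≡n∸m)
open import Data.Nat.Divisibility using (_∣_; divides; ∣-trans)
open import Data.Nat.GCD using (gcd; gcd[m,n]∣m; gcd[m,n]∣n)
open import Data.Product using (∃; _×_; _,_)
open import Data.Unit using (tt)
open import Data.Maybe using (just; nothing; fromMaybe)
open import Data.List.Properties using (map-∘; map-cong)
open import Data.List.Relation.Unary.Any using (any?)
open import Data.List.Relation.Binary.Subset.Propositional.Properties
  using (Any-resp-⊆) renaming (map⁺ to map⁺-⊆)
open import Data.Bool using (true)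
open import Data.Bool.Properties using () renaming (_≟_ to _≟ᵇ_)
open import Relation.Nullary using (¬_; Dec)
open import Relation.Nullary.Decidable using (decidable-stable)
open import Relation.Binary.PropositionalEquality
  using (_≡_; sym; trans; cong; cong₂; subst; module ≡-Reasoning)
open import Relation.Binary.Construct.Closure.ReflexiveTransitive using (Star; ε; _◅_)
open import Function.Bundles using (_⇔_; mk⇔)
open Label
open LClause

shiftClause-∘ : ∀ {n} t u (C : Clause n) →
  shiftClause t (shiftClause u C) ≡ shiftClause (u + t) C
shiftClause-∘ t u C = trans (sym (map-∘ C)) (map-cong shiftLit-∘ C)
  where
  shiftLit-∘ : ∀ x → shiftLit t (shiftLit u x) ≡ shiftLit (u + t) x
  shiftLit-∘ (pos (p , i)) = cong (λ j → pos (p , j)) (+-assoc i u t)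
  shiftLit-∘ (neg (p , i)) = cong (λ j → neg (p , j)) (+-assoc i u t)

satisfies? : ∀ {n} (W : Valuation n) (C : Clause n) → Dec (Satisfies W C)
satisfies? W = any? (λ x → litVal W x ≟ᵇ true)

Satisfies-⊆ : ∀ {n} (W : Valuation n) t {C D : Clause n} → C ⊆ᶜ D →
  Satisfies W (shiftClause t C) → Satisfies W (shiftClause t D)
Satisfies-⊆ W t C⊆D = Any-resp-⊆ (map⁺-⊆ (shiftLit t) C⊆D)

condK-+-multiple : ∀ {K L k d t} → L ∣ d →
  condK K L (just k) t → condK K L (just (k + d)) t
condK-+-multiple {K} {L} {k} {d} {t} (divides m d≡mL) (s , t+k≡K+sL) =
  s + m , (begin
    t + (k + d)          ≡⟨ sym (+-assoc t k d) ⟩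
    t + k + d            ≡⟨ cong₂ _+_ t+k≡K+sL d≡mL ⟩
    K + s * L + m * L    ≡⟨ +-assoc K _ _ ⟩
    K + (s * L + m * L)  ≡⟨ cong (K +_) (sym (*-distribʳ-+ L s m)) ⟩
    K + (s + m) * L      ∎)
  where open ≡-Reasoning

mergeL∣l₁ : ∀ k₁ k₂ l₁ l₂ → mergeL k₁ k₂ l₁ l₂ ∣ l₁
mergeL∣l₁ (just k₁) (just k₂) l₁ l₂ =
  ∣-trans (gcd[m,n]∣m (gcd l₁ l₂) ∣ k₁ - k₂ ∣) (gcd[m,n]∣m l₁ l₂)
mergeL∣l₁ (just _) nothing l₁ l₂ = gcd[m,n]∣m l₁ l₂
mergeL∣l₁ nothing _ l₁ l₂ = gcd[m,n]∣m l₁ l₂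

mergeB-≡ʳ⇒condB : ∀ {b₁ b₂ t} → mergeB b₁ b₂ ≡ b₂ → condB b₂ t → condB b₁ t
mergeB-≡ʳ⇒condB {⋆} _ _ = tt
mergeB-≡ʳ⇒condB {𝟘} {𝟘} _ t≡0 = t≡0

mergeK-≡ʳ⇒condK : ∀ {K L k₁ k₂ l₁ l₂ t} →
  mergeK k₁ k₂ ≡ k₂ → mergeL k₁ k₂ l₁ l₂ ≡ l₂ → L ∣ l₂ →
  condK K L k₂ t → condK K L k₁ t
mergeK-≡ʳ⇒condK {k₁ = nothing} _ _ _ _ = tt
mergeK-≡ʳ⇒condK {K} {L} {just k₁} {just k₂} {l₁} {l₂} {t} k₁⊓k₂≡k₂ gcd≡l₂ L∣l₂ ck₂ =
  subst (λ k → condK K L (just k) t) (m+[n∸m]≡n k₂≤k₁) (condK-+-multiple {k = k₂} L∣k₁∸k₂ ck₂)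
  where
  k₂≤k₁ : k₂ ≤ k₁
  k₂≤k₁ = m⊓n≡n⇒n≤m (cong (fromMaybe 0) k₁⊓k₂≡k₂)
  l₂∣∣k₁-k₂∣ : l₂ ∣ ∣ k₁ - k₂ ∣
  l₂∣∣k₁-k₂∣ = subst (_∣ ∣ k₁ - k₂ ∣) gcd≡l₂ (gcd[m,n]∣n (gcd l₁ l₂) ∣ k₁ - k₂ ∣)
  L∣k₁∸k₂ : L ∣ k₁ ∸ k₂
  L∣k₁∸k₂ = ∣-trans L∣l₂ (subst (l₂ ∣_) (m≤n⇒∣n-m∣≡n∸m k₂≤k₁) l₂∣∣k₁-k₂∣)

merge-≡ʳ⇒InR : ∀ {K L t} λ₁ λ₂ → merge λ₁ λ₂ ≡ λ₂ → InR K L λ₂ t → InR K L λ₁ t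
merge-≡ʳ⇒InR ⟨ b₁ , k₁ , l₁ ⟩ ⟨ b₂ , k₂ , l₂ ⟩ merge≡λ₂ (cb₂ , ck₂ , L∣l₂) =
    mergeB-≡ʳ⇒condB (cong b merge≡λ₂) cb₂
  , mergeK-≡ʳ⇒condK (cong k merge≡λ₂) mergeL≡l₂ L∣l₂ ck₂
  , ∣-trans L∣l₂ (subst (_∣ l₁) mergeL≡l₂ (mergeL∣l₁ k₁ k₂ l₁ l₂))
  where
  mergeL≡l₂ : mergeL k₁ k₂ l₁ l₂ ≡ l₂
  mergeL≡l₂ = cong l merge≡λ₂

module _ {n : ℕ} (K L : ℕ) (W : Valuation n) where

  SatisfiesInstances : LClause n → Set
  SatisfiesInstances 𝒞 = ∀ t → InR K L (label 𝒞) t → Satisfies W (shiftClause t (clause 𝒞))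

  TimeShift-preserves : ∀ {𝒞 𝒞'} → TimeShift 𝒞 𝒞' →
    SatisfiesInstances 𝒞 → SatisfiesInstances 𝒞'
  TimeShift-preserves (shift-* l C) sat t (_ , _ , L∣l) =
    subst (Satisfies W) (sym (shiftClause-∘ t 1 C)) (sat (suc t) (tt , tt , L∣l))
  TimeShift-preserves (shift-k k l C) sat t (_ , (s , t+[1+k]≡K+sL) , L∣l) =
    subst (Satisfies W) (sym (shiftClause-∘ t 1 C))
      (sat (suc t) (tt , (s , trans (sym (+-suc t k)) t+[1+k]≡K+sL) , L∣l))

  TimeShifts-preserve : ∀ {𝒞 𝒞'} → Star TimeShift 𝒞 𝒞' →
    SatisfiesInstances 𝒞 → SatisfiesInstances 𝒞'
  TimeShifts-preserve ε sat = sat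
  TimeShifts-preserve (step ◅ steps) sat = TimeShifts-preserve steps (TimeShift-preserves step sat)

  BasicSubsumes-preserves : ∀ 𝒞 𝒟 → BasicSubsumes 𝒞 𝒟 →
    SatisfiesInstances 𝒞 → SatisfiesInstances 𝒟
  BasicSubsumes-preserves (λ₁ ▸ C) (λ₂ ▸ D) (C⊆D , merge≡λ₂) sat t t∈R =
    Satisfies-⊆ W t C⊆D (sat t (merge-≡ʳ⇒InR λ₁ λ₂ merge≡λ₂ t∈R))

  Subsumes-preserves : ∀ 𝒞 𝒟 → Subsumes 𝒞 𝒟 →
    SatisfiesInstances 𝒞 → SatisfiesInstances 𝒟
  Subsumes-preserves 𝒞 𝒟 (𝒞' , steps , basic) sat =
    BasicSubsumes-preserves 𝒞' 𝒟 basic (TimeShifts-preserve steps sat)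

  -- Membership in Ñ is not decidable, but satisfaction of a single instance is, so the
  -- case split "𝒟 ∈ Ñ or not" is done under a double negation of that instance.
  covered-satisfiesInstances : ∀ (N Ñ : LSet n) →
    (∀ 𝒟 → N 𝒟 → ¬ Ñ 𝒟 → ∃ λ 𝒞 → Ñ 𝒞 × Subsumes 𝒞 𝒟) →
    (∀ 𝒞 → Ñ 𝒞 → SatisfiesInstances 𝒞) →
    ∀ 𝒟 → N 𝒟 → SatisfiesInstances 𝒟
  covered-satisfiesInstances N Ñ cover satÑ 𝒟 N𝒟 t t∈R =
    decidable-stable (satisfies? W (shiftClause t (clause 𝒟))) λ unsat →
      let 𝒞 , Ñ𝒞 , 𝒞≼𝒟 = cover 𝒟 N𝒟 (λ Ñ𝒟 → unsat (satÑ 𝒟 Ñ𝒟 t t∈R))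
      in unsat (Subsumes-preserves 𝒞 𝒟 𝒞≼𝒟 (satÑ 𝒞 Ñ𝒞) t t∈R)

theorem3 : ∀ {n : ℕ} (N Ñ : LSet n) →
    (∀ 𝒞 → Ñ 𝒞 → N 𝒞) →
    (∀ 𝒟 → N 𝒟 → ¬ Ñ 𝒟 → ∃ λ 𝒞 → Ñ 𝒞 × Subsumes 𝒞 𝒟) →
    ∀ (K L : ℕ) → NonZero L →
    (Satisfiable K L N ⇔ Satisfiable K L Ñ)
theorem3 N Ñ Ñ⊆N cover K L _ = mk⇔
  (λ (W , satN) → W , λ 𝒞 Ñ𝒞 → satN 𝒞 (Ñ⊆N 𝒞 Ñ𝒞))
  (λ (W , satÑ) → W , covered-satisfiesInstances K L W N Ñ cover satÑ)
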